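{- Let $M$ be a finite LTS and $B\subseteq\mathit{Act}$. Every $B$-progressing, finite path satisfies every finitely realisable path predicate (with respect to $B$).
   Context: LTS $M=(S,s_{init},\mathit{Act},\mathit{Trans})$ with $S,\mathit{Act}$ finite. Paths: alternating sequences $s_0t_1s_1\dots$ starting in a state, infinite or ending in a state (final state), consecutive. An action occurs on a path if a transition on it carries that label. An action is enabled in $s$ if a transition with that label leaves $s$. $\overline{B}=\mathit{Act}\setminus B$. A state is $B$-locked if all actions enabled in it are in $B$; a path is $B$-progressing if infinite or its final state is $B$-locked. A path predicate $P$ is finitely realisable if there are mappings $\phi_{on},\phi_{off}$ from $\overline{B}$ to closed modal $\mu$-calculus formulae and $\alpha_{el}$ from $\overline{B}$ to subsets of $\mathit{Act}$ such that: (1) a path $\pi$ satisfies $P$ iff for every state $s$ on $\pi$ and every $a\in\overline{B}$ with $s\in[\![\phi_{on}(a)]\!]$, the suffix of $\pi$ from $s$ contains an occurrence of an action in $\alpha_{el}(a)$ or a state satisfying $\phi_{off}(a)$; (2) $s$ is $B$-locked iff $s\notin[\![\phi_{on}(a)]\!]$ for all $a\in\overline{B}$; (3) $s\in[\![\phi_{on}(a)]\!]$ implies $s\notin[\![\phi_{off}(a)]\!]$; (4) if $s\in[\![\phi_{on}(a)]\!]$ and a finite path from $s$ to $s'$ contains no occurrence of an action in $\alpha_{el}(a)$ and no state satisfying $\phi_{off}(a)$, then $s'\in[\![\phi_{on}(a)]\!]$. Here $[\![\phi]\!]$ is the set of states satisfying the closed formula $\phi$ under the standard modal $\mu$-calculus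 semantics. -}

module Defs where

open import Data.Nat using (ℕ; zero; suc; _≤_)
open import Data.Fin using (Fin; zero; suc; toℕ; inject₁; fromℕ)
open import Data.Fin.Subset using (Subset; _∈_; _∉_)
open import Data.Bool using (Bool; true)
open import Data.Product using (Σ; ∃; ∃-syntax; _×_; _,_)
open import Data.Sum using (_⊎_)
open import Data.Empty using (⊥)
open import Data.Unit using (⊤)
open import Relation.Nullary using (¬_)
open import Relation.Binary.PropositionalEquality using (_≡_)
open import Function.Bundles using (_⇔_)

record LTS : Set where
  field
    nS    : ℕ
    nA    : ℕ
    init  : Fin nS
    trans : Fin nS → Fin nA → Fin nS → Bool

module _ (M : LTS) where
  open LTS M

  State  = Fin nS
  Action = Fin nA

  _─[_]→_ : State → Action → State → Set
  s ─[ a ]→ t = trans s a t ≡ true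

  -- Paths: finite (s₀ t₁ s₁ … t_k s_k, k ≥ 0) or infinite.
  -- Transition number i (0-based) has label ac i and goes from
  -- state i to state i+1.

  data Path : Set where
    finP : (k : ℕ) (st : Fin (suc k) → State) (ac : Fin k → Action) →
           (∀ (i : Fin k) → st (inject₁ i) ─[ ac i ]→ st (suc i)) → Path
    infP : (st : ℕ → State) (ac : ℕ → Action) →
           (∀ (i : ℕ) → st i ─[ ac i ]→ st (suc i)) → Path

  IsFinite : Path → Set
  IsFinite (finP _ _ _ _) = ⊤
  IsFinite (infP _ _ _)   = ⊥

  Enabled : Action → State → Set
  Enabled a s = ∃[ t ] (s ─[ a ]→ t)

  Locked : Subset nA → State → Set
  Locked B s = ∀ a → Enabled a s → a ∈ B

  Progressing : Subset nA → Path → Set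
  Progressing B (finP k st ac _) = Locked B (st (fromℕ k))
  Progressing B (infP _ _ _)     = ⊤

  -- Modal μ-calculus (positive normal form, de Bruijn variables).
  -- Form k = formulae with at most k free fixpoint variables.

  data Form (k : ℕ) : Set where
    tt ff  : Form k
    var    : Fin k → Form k
    _∧f_   : Form k → Form k → Form k
    _∨f_   : Form k → Form k → Form k
    ⟨_⟩_   : Action → Form k → Form k
    [_]_   : Action → Form k → Form k
    μf νf  : Form (suc k) → Form k

  Env : ℕ → Set
  Env k = Fin k → Subset nS

  extend : ∀ {k} → Subset nS → Env k → Env (suc k)
  extend U ρ zero    = U
  extend U ρ (suc i) = ρ i

  -- standard semantics; fixpoints via Knaster–Tarski over the (finite)
  -- powerset of states
  Sat : ∀ {k} → Form k → Env k → State → Set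
  Sat tt        ρ s = ⊤
  Sat ff        ρ s = ⊥
  Sat (var i)   ρ s = s ∈ ρ i
  Sat (φ ∧f ψ)  ρ s = Sat φ ρ s × Sat ψ ρ s
  Sat (φ ∨f ψ)  ρ s = Sat φ ρ s ⊎ Sat ψ ρ s
  Sat (⟨ a ⟩ φ) ρ s = ∃[ t ] (s ─[ a ]→ t × Sat φ ρ t)
  Sat ([ a ] φ) ρ s = ∀ t → s ─[ a ]→ t → Sat φ ρ t
  Sat (μf φ)    ρ s = ∀ (U : Subset nS) →
                        (∀ t → Sat φ (extend U ρ) t → t ∈ U) → s ∈ U
  Sat (νf φ)    ρ s = Σ (Subset nS) λ U →
                        (∀ t → t ∈ U → Sat φ (extend U ρ) t) × s ∈ U

  emptyEnv : Env 0
  emptyEnv ()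

  ⟦_⟧ : Form 0 → State → Set
  ⟦ φ ⟧ s = Sat φ emptyEnv s

  -- Finitely realisable path predicates.
  -- The mappings are given as total functions on Act; only their values
  -- on the complement of B are ever used.

  SuffixCond : Subset nA → (Action → Form 0) → (Action → Form 0) →
               (Action → Subset nA) → Path → Set
  SuffixCond B on off α (finP k st ac _) =
    ∀ (i : Fin (suc k)) (a : Action) → a ∉ B → ⟦ on a ⟧ (st i) →
      (∃[ j ] (toℕ i ≤ toℕ j × ⟦ off a ⟧ (st j)))
      ⊎ (∃[ j ] (toℕ i ≤ toℕ j × ac j ∈ α a))
  SuffixCond B on off α (infP st ac _) =
    ∀ (i : ℕ) (a : Action) → a ∉ B → ⟦ on a ⟧ (st i) →
      (∃[ j ] (i ≤ j × ⟦ off a ⟧ (st j)))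
      ⊎ (∃[ j ] (i ≤ j × ac j ∈ α a))

  record FinitelyRealisable (B : Subset nA) (P : Path → Set) : Set where
    field
      φon   : Action → Form 0
      φoff  : Action → Form 0
      αel   : Action → Subset nA
      char  : ∀ (π : Path) → P π ⇔ SuffixCond B φon φoff αel π
      lock  : ∀ (s : State) →
                Locked B s ⇔ (∀ a → a ∉ B → ¬ ⟦ φon a ⟧ s)
      onOff : ∀ (a : Action) → a ∉ B → ∀ s → ⟦ φon a ⟧ s → ¬ ⟦ φoff a ⟧ s
      stay  : ∀ (a : Action) → a ∉ B →
                ∀ (k : ℕ) (st : Fin (suc k) → State) (ac : Fin k → Action) →
                (∀ (i : Fin k) → st (inject₁ i) ─[ ac i ]→ st (suc i)) →
                ⟦ φon a ⟧ (st zero) →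
                (∀ (i : Fin k) → ac i ∉ αel a) →
                (∀ (i : Fin (suc k)) → ¬ ⟦ φoff a ⟧ (st i)) →
                ⟦ φon a ⟧ (st (fromℕ k))

{-# OPTIONS --safe #-}
-- Let a ∉ B hold φon(a) at position i of a finite B-progressing path. If no
-- later transition is labelled in αel(a) and no later state satisfies
-- φoff(a), condition (4) carries φon(a) step by step to the final state;
-- that state is B-locked, so by (2) it satisfies no φon(a), a contradiction.
-- The case distinction is constructive because satisfaction is decidable:
-- fixpoints quantify over the finitely many sets of states.
module Submission where

open import Defs
open import Data.Fin.Subset using (Subset; _∉_)
open import Data.Nat using (suc; _≤?_) renaming (_≤_ to _≤ℕ_)
open import Data.Fin using (Fin; zero; suc; toℕ; inject₁; fromℕ; _≤_)
open import Data.Fin.Induction using (<-weakInduction-startingFrom)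
open import Data.Fin.Properties
  using (any?; all?; ≤-refl; ≤fromℕ; i≤inject₁[j]⇒i≤1+j; toℕ-inject₁)
open import Data.Fin.Subset.Properties using (anySubset?; _∈?_)
open import Data.Bool using (true)
open import Data.Bool.Properties using () renaming (_≟_ to _≟ᵇ_)
open import Data.Product using (_×_; _,_; proj₂)
open import Data.Sum using (inj₁; inj₂)
open import Data.Empty using (⊥-elim)
open import Data.Unit using (tt)
open import Relation.Nullary using (¬_; Dec; yes; no)
open import Relation.Nullary.Decidable
  using (_×-dec_; _⊎-dec_; _→-dec_; ¬?; decidable-stable)
open import Relation.Binary.PropositionalEquality using (subst)
open import Function.Bundles using (Equivalence)

allSubset? : ∀ {n} {Q : Subset n → Set} → (∀ U → Dec (Q U)) → Dec (∀ U → Q U)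
allSubset? q? with anySubset? (λ U → ¬? (q? U))
... | yes (U , ¬q) = no (λ q → ¬q (q U))
... | no ∄¬q      = yes (λ U → decidable-stable (q? U) (λ ¬q → ∄¬q (U , ¬q)))

module _ (M : LTS) where

  transition? : ∀ s a t → Dec (_─[_]→_ M s a t)
  transition? s a t = LTS.trans M s a t ≟ᵇ true

  sat? : ∀ {k} (φ : Form M k) (ρ : Env M k) s → Dec (Sat M φ ρ s)
  sat? tt        ρ s = yes tt
  sat? ff        ρ s = no (λ ())
  sat? (var i)   ρ s = s ∈? ρ i
  sat? (φ ∧f ψ)  ρ s = sat? φ ρ s ×-dec sat? ψ ρ s
  sat? (φ ∨f ψ)  ρ s = sat? φ ρ s ⊎-dec sat? ψ ρ s
  sat? (⟨ a ⟩ φ) ρ s = any? (λ t → transition? s a t ×-dec sat? φ ρ t)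
  sat? ([ a ] φ) ρ s = all? (λ t → transition? s a t →-dec sat? φ ρ t)
  sat? (μf φ)    ρ s = allSubset? (λ U →
    all? (λ t → sat? φ (extend M U ρ) t →-dec t ∈? U) →-dec s ∈? U)
  sat? (νf φ)    ρ s = anySubset? (λ U →
    all? (λ t → t ∈? U →-dec sat? φ (extend M U ρ) t) ×-dec s ∈? U)

module _ {M : LTS} {B : Subset (LTS.nA M)} {P : Path M → Set}
         (FR : FinitelyRealisable M B P) where
  open FinitelyRealisable FR

  On Off : Action M → State M → Set
  On  a = ⟦_⟧ M (φon a)
  Off a = ⟦_⟧ M (φoff a)

  on-step : ∀ {a} → a ∉ B → ∀ {s b t} → _─[_]→_ M s b t →
            On a s → b ∉ αel a → ¬ Off a s → ¬ Off a t → On a t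
  on-step a∉B {s} {b} {t} s→t on-s b∉α ¬off-s ¬off-t =
    stay _ a∉B 1 (λ { zero → s ; (suc zero) → t }) (λ _ → b)
      (λ { zero → s→t }) on-s (λ { zero → b∉α })
      (λ { zero → ¬off-s ; (suc zero) → ¬off-t })

  on-persists-to-end :
    ∀ {a} → a ∉ B →
    ∀ {k} {st : Fin (suc k) → State M} {ac : Fin k → Action M} →
    (∀ j → _─[_]→_ M (st (inject₁ j)) (ac j) (st (suc j))) →
    ∀ {i} → On a (st i) →
    (∀ j → toℕ i ≤ℕ toℕ j → ¬ Off a (st j)) →
    (∀ j → toℕ i ≤ℕ toℕ j → ac j ∉ αel a) →
    On a (st (fromℕ k))
  on-persists-to-end {a} a∉B {k} {st} {ac} tr {i} on-i ¬off ¬α =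
    proj₂ (<-weakInduction-startingFrom OnFrom (≤-refl , on-i) step (≤fromℕ i))
    where
    OnFrom : Fin (suc k) → Set
    OnFrom j = i ≤ j × On a (st j)

    step : ∀ j → OnFrom (inject₁ j) → OnFrom (suc j)
    step j (i≤j , on-j) =
      i≤1+j , on-step a∉B (tr j) on-j
                (¬α j (subst (toℕ i ≤ℕ_) (toℕ-inject₁ j) i≤j))
                (¬off _ i≤j) (¬off _ i≤1+j)
      where
      i≤1+j : i ≤ suc j
      i≤1+j = i≤inject₁[j]⇒i≤1+j i≤j

  progressing⇒suffixCond : ∀ k st ac tr → Locked M B (st (fromℕ k)) →
                           SuffixCond M B φon φoff αel (finP k st ac tr)
  progressing⇒suffixCond k st ac tr locked i a a∉B on-i
    with any? (λ j → toℕ i ≤? toℕ j ×-dec sat? M (φoff a) (emptyEnv M) (st j))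
         ⊎-dec any? (λ j → toℕ i ≤? toℕ j ×-dec ac j ∈? αel a)
  ... | yes witness = witness
  ... | no none     = ⊥-elim (Equivalence.to (lock (st (fromℕ k))) locked a a∉B
                        (on-persists-to-end a∉B tr on-i
                          (λ j i≤j off → none (inj₁ (j , i≤j , off)))
                          (λ j i≤j α   → none (inj₂ (j , i≤j , α)))))

proposition46 : (M : LTS) (B : Subset (LTS.nA M)) (P : Path M → Set) →
                FinitelyRealisable M B P →
                ∀ (π : Path M) → IsFinite M π → Progressing M B π → P π
proposition46 M B P FR (finP k st ac tr) _ locked =
  Equivalence.from (char (finP k st ac tr)) (progressing⇒suffixCond FR k st ac tr locked)
  where open FinitelyRealisable FR
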